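{- If a colored Büchi graph with costs has an initial pumpable fair path, then it also has an initial pumpable fair path of the form $\pi_0\pi_1^\omega$ with $|\pi_0\pi_1|\in\mathcal{O}(n^2)$, where $n$ is the number of vertices of the graph.
   Context: Fix a proposition $p$. A colored Büchi graph with costs $(V,v_I,E,\ell,\mathrm{cst},F)$ consists of a finite directed graph $(V,E)$, an initial vertex $v_I$, a labeling $\ell:V\to 2^{\{p\}}$, a cost function $\mathrm{cst}:E\to\mathbb{N}$, and a set $F\subseteq V$ of accepting vertices. A path is an infinite sequence $v_0v_1\cdots$ with $(v_j,v_{j+1})\in E$; it is initial if $v_0=v_I$. A position $j$ of a path is a changepoint if $j=0$ or $\ell(v_{j-1})\ne\ell(v_j)$; a block is a maximal infix $v_j\cdots v_{j+m}$ such that $j$ and $j+m+1$ are successive changepoints (the suffix after the last changepoint, if there are finitely many, is the tail and is not a block). A path is pumpable if each of its blocks contains a vertex repetition $v_a=v_b$ ($a<b$ within the block) such that the cycle $v_a\cdots v_b$ has non-zero cost, i.e., $\sum_{i=a}^{b-1}\mathrm{cst}(v_i,v_{i+1})>0$ (no requirement on the tail). A path is fair if it visits $F$ infinitely often. -}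

module Defs where

open import Data.Nat using (ℕ; zero; suc; _+_; _*_; _∸_; _≤_; _<_; _<?_)
open import Data.Nat.DivMod using (_mod_)
open import Data.Fin using (Fin; fromℕ<)
open import Data.Vec using (Vec; lookup)
open import Data.Bool using (Bool; true)
open import Data.Unit using (⊤)
open import Data.Product using (Σ; ∃; _×_; _,_)
open import Data.Sum using (_⊎_)
open import Relation.Nullary using (¬_; yes; no)
open import Relation.Binary.PropositionalEquality using (_≡_)

-- Labels ℓ : V → 2^{p} are encoded as Bool (true ↔ p holds).
-- The cost function is given on all pairs but only matters on edges.
record CBGraph (n : ℕ) : Set where
  field
    vI  : Fin n
    E   : Fin n → Fin n → Bool
    ℓ   : Fin n → Bool
    cst : Fin n → Fin n → ℕ
    F   : Fin n → Bool

module _ {n : ℕ} (G : CBGraph n) where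
  open CBGraph G

  IsPath : (ℕ → Fin n) → Set
  IsPath ρ = ∀ j → E (ρ j) (ρ (suc j)) ≡ true

  IsInitial : (ℕ → Fin n) → Set
  IsInitial ρ = ρ 0 ≡ vI

  Changepoint : (ℕ → Fin n) → ℕ → Set
  Changepoint ρ zero    = ⊤
  Changepoint ρ (suc j) = ¬ (ℓ (ρ j) ≡ ℓ (ρ (suc j)))

  Block : (ℕ → Fin n) → ℕ → ℕ → Set
  Block ρ j k =
    Changepoint ρ j × j ≤ k × Changepoint ρ (suc k) ×
    (∀ i → j < i → i ≤ k → ¬ Changepoint ρ i)

  segCost : (ℕ → Fin n) → ℕ → ℕ → ℕ
  segCost ρ a zero    = 0
  segCost ρ a (suc m) = cst (ρ a) (ρ (suc a)) + segCost ρ (suc a) m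

  IsPumpable : (ℕ → Fin n) → Set
  IsPumpable ρ = ∀ j k → Block ρ j k →
    Σ ℕ λ a → Σ ℕ λ b →
      j ≤ a × a < b × b ≤ k × ρ a ≡ ρ b × 0 < segCost ρ a (b ∸ a)

  IsFair : (ℕ → Fin n) → Set
  IsFair ρ = ∀ i → Σ ℕ λ j → i ≤ j × F (ρ j) ≡ true

  IsInitialPumpableFairPath : (ℕ → Fin n) → Set
  IsInitialPumpableFairPath ρ =
    IsPath ρ × IsInitial ρ × IsPumpable ρ × IsFair ρ

lasso : {n k₀ k₁ : ℕ} → Vec (Fin n) k₀ → Vec (Fin n) (suc k₁) → ℕ → Fin n
lasso {k₀ = k₀} {k₁} π₀ π₁ j with j <? k₀
... | yes j<k₀ = lookup π₀ (fromℕ< j<k₀)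
... | no  _    = lookup π₁ ((j ∸ k₀) mod suc k₁)

-- Pumpability of a block is recognised by a finite automaton reading the block: it is
-- `seeking` until it guesses the start x of a vertex repetition, then `looping x b`
-- (b: the loop has positive cost so far) until it returns to x with positive cost, and
-- `found` afterwards; the label may change only in mode `found`.  Paths of the product
-- of the graph with this automaton, started in `seeking`, project to pumpable paths,
-- and a pumpable path lifts to product walks between any of its changepoints.  In a fair
-- pumpable path ρ there are positions u ≤ p < v with ρ u = ρ v, ρ p accepting, and a
-- product walk from u to v: either two equal accepting vertices with no changepoint in
-- between, or, among n + 1 changepoints with accepting visits in between, two carrying
-- the same vertex.  The product walks 0 → p and p → v ≈ u → p form a lasso through an
-- accepting state, and cutting loops brings each below the number n (2n + 2) of product
-- states, so the lasso has length at most 8n².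

module Submission where

open import Defs
open import Data.Bool using (Bool; true; false; T)
open import Data.Bool.Properties using () renaming (_≟_ to _≟ᵇ_)
open import Data.Empty using (⊥-elim)
open import Data.Fin using (Fin; toℕ; fromℕ<; combine) renaming (zero to fzero; suc to fsuc)
open import Data.Fin.Properties using (pigeonhole; combine-injective; toℕ<n; toℕ-fromℕ<)
  renaming (suc-injective to fsuc-injective)
open import Data.Nat
  using (ℕ; zero; suc; _+_; _*_; _∸_; _≤_; _<_; _≤‴_; ≤‴-refl; ≤‴-step; _<?_; _≤?_; _<ᵇ_;
         z≤n; s≤s; s<s⁻¹; s≤s⁻¹; NonZero)
open import Data.Nat.DivMod
  using (_%_; _mod_; m%n<n; m<n⇒m%n≡m; n%n≡0; m%n%n≡m%n; %-distribˡ-+; [m+kn]%n≡m%n)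
open import Data.Nat.Induction using (<-wellFounded)
open import Data.Nat.Properties
open import Data.Nat.Tactic.RingSolver using (solve-∀)
open import Data.Product using (Σ; Σ-syntax; _×_; _,_; proj₁; proj₂)
open import Data.Sum using (_⊎_; inj₁; inj₂; map₁)
open import Data.Unit using (⊤; tt)
open import Data.Vec using (Vec; tabulate)
open import Data.Vec.Properties using (lookup∘tabulate)
open import Induction.WellFounded using (Acc; acc)
open import Relation.Nullary using (¬_; yes; no)
open import Relation.Nullary.Decidable using (decidable-stable)
open import Relation.Binary.PropositionalEquality
open import Function using (_∘_)

module _ {f : ℕ → ℕ} (f-increasing : ∀ i → f i < f (suc i)) where

  increasing⇒mono-< : ∀ {i j} → i < j → f i < f j
  increasing⇒mono-< {i} {suc j} i<1+j with m≤n⇒m<n∨m≡n (s≤s⁻¹ i<1+j)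
  ... | inj₁ i<j  = <-trans (increasing⇒mono-< i<j) (f-increasing j)
  ... | inj₂ refl = f-increasing i

  increasing⇒mono-≤ : ∀ {i j} → i ≤ j → f i ≤ f j
  increasing⇒mono-≤ i≤j with m≤n⇒m<n∨m≡n i≤j
  ... | inj₁ i<j  = <⇒≤ (increasing⇒mono-< i<j)
  ... | inj₂ refl = ≤-refl

+-positive : ∀ {m n} → 0 < m ⊎ 0 < n → 0 < m + n
+-positive {m} {n} (inj₁ 0<m) = <-≤-trans 0<m (m≤m+n m n)
+-positive {m} {n} (inj₂ 0<n) = <-≤-trans 0<n (m≤n+m n m)

+-positive⁻ : ∀ m {n} → 0 < m + n → 0 < m ⊎ 0 < n
+-positive⁻ zero    0<n = inj₂ 0<n
+-positive⁻ (suc m) _   = inj₁ (s≤s z≤n)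

suc-% : ∀ m n .{{_ : NonZero n}} → suc m % n ≡ suc (m % n) % n
suc-% m n = begin
  (1 + m) % n                 ≡⟨ %-distribˡ-+ 1 m n ⟩
  (1 % n + m % n) % n         ≡⟨ cong (λ k → (1 % n + k) % n) (m%n%n≡m%n m n) ⟨
  (1 % n + m % n % n) % n     ≡⟨ %-distribˡ-+ 1 (m % n) n ⟨
  (1 + m % n) % n             ∎
  where open ≡-Reasoning

record Walk {S : Set} (R : S → S → Set) (x y : S) : Set where
  field
    len   : ℕ
    at    : ℕ → S
    at-start : at 0 ≡ x
    at-end   : at len ≡ y
    steps : ∀ i → i < len → R (at i) (at (suc i))

open Walk

module _ {S : Set} {R : S → S → Set} where

  nil : ∀ {x} → Walk R x x
  nil {x} = record { len = 0 ; at = λ _ → x ; at-start = refl ; at-end = refl ; steps = λ _ () }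

  _◅_ : ∀ {x y z} → R x y → Walk R y z → Walk R x z
  _◅_ {x} r W = record
    { len   = suc (len W)
    ; at    = λ { zero → x ; (suc i) → at W i }
    ; at-start = refl
    ; at-end   = at-end W
    ; steps = λ { zero _ → subst (R x) (sym (at-start W)) r
                ; (suc i) i<1+len → steps W i (s<s⁻¹ i<1+len) } }

  cast : ∀ {x y x' y'} → x ≡ x' → y ≡ y' → Walk R x y → Walk R x' y'
  cast x≡x' y≡y' W = record
    { len = len W ; at = at W ; steps = steps W
    ; at-start = trans (at-start W) x≡x' ; at-end = trans (at-end W) y≡y' }

  _◅◅_ : ∀ {x y z} → Walk R x y → Walk R y z → Walk R x z
  _◅◅_ {x} {y} {z} A B = record
    { len = len A + len B ; at = f ; steps = f-steps
    ; at-start = trans (f-left z≤n) (at-start A) ; at-end = f-at-end }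
    where
    f : ℕ → S
    f i with i ≤? len A
    ... | yes _ = at A i
    ... | no  _ = at B (i ∸ len A)

    f-left : ∀ {i} → i ≤ len A → f i ≡ at A i
    f-left {i} i≤ with i ≤? len A
    ... | yes _ = refl
    ... | no i≰ = ⊥-elim (i≰ i≤)

    f-right : ∀ {i} → len A ≤ i → f i ≡ at B (i ∸ len A)
    f-right {i} ≤i with i ≤? len A
    ... | no _ = refl
    ... | yes i≤ with refl ← ≤-antisym ≤i i≤ = begin
      at A (len A)         ≡⟨ trans (at-end A) (sym (at-start B)) ⟩
      at B 0               ≡⟨ cong (at B) (n∸n≡0 (len A)) ⟨
      at B (len A ∸ len A) ∎
      where open ≡-Reasoning

    f-at-end : f (len A + len B) ≡ z
    f-at-end = trans (f-right (m≤m+n _ _)) (trans (cong (at B) (m+n∸m≡n (len A) (len B))) (at-end B))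

    f-steps : ∀ i → i < len A + len B → R (f i) (f (suc i))
    f-steps i i< with ≤-<-connex (suc i) (len A)
    ... | inj₁ 1+i≤ = subst₂ R (sym (f-left (<⇒≤ 1+i≤))) (sym (f-left 1+i≤)) (steps A i 1+i≤)
    ... | inj₂ A<1+i = subst₂ R (sym (f-right A≤i)) (sym (f-right (m≤n⇒m≤1+n A≤i)))
                      (subst (λ k → R (at B (i ∸ len A)) (at B k)) (sym (+-∸-assoc 1 A≤i))
                        (steps B (i ∸ len A)
                          (subst (i ∸ len A <_) (m+n∸m≡n (len A) (len B)) (∸-monoˡ-< i< A≤i))))
      where
      A≤i : len A ≤ i
      A≤i = s≤s⁻¹ A<1+i

  slice : ∀ {x y} (W : Walk R x y) {i j} → i ≤ j → j ≤ len W → Walk R (at W i) (at W j)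
  slice W {i} {j} i≤j j≤len = record
    { len   = j ∸ i
    ; at    = λ k → at W (i + k)
    ; at-start = cong (at W) (+-identityʳ i)
    ; at-end   = cong (at W) (m+[n∸m]≡n i≤j)
    ; steps = λ k k< → subst (λ l → R (at W (i + k)) (at W l)) (sym (+-suc i k))
                (steps W (i + k) (<-≤-trans (subst (i + k <_) (m+[n∸m]≡n i≤j) (+-monoʳ-< i k<)) j≤len)) }

  module _ {N : ℕ} (encode : S → Fin N) (encode-injective : ∀ {a b} → encode a ≡ encode b → a ≡ b) where

    cutLoop : ∀ {x y} (W : Walk R x y) → N ≤ len W → Σ[ W' ∈ Walk R x y ] len W' < len W
    cutLoop W N≤len with i , j , i<j , same ← pigeonhole (n<1+n N) (λ k → encode (at W (toℕ k))) =
      cast (at-start W) (at-end W)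
        (cast refl (encode-injective same) (slice W z≤n a≤len) ◅◅ slice W b≤len ≤-refl) ,
      (begin-strict
        a + (len W ∸ b) <⟨ +-monoˡ-< (len W ∸ b) i<j ⟩
        b + (len W ∸ b) ≡⟨ m+[n∸m]≡n b≤len ⟩
        len W           ∎)
      where
      open ≤-Reasoning
      a b : ℕ
      a = toℕ i
      b = toℕ j
      b≤len : b ≤ len W
      b≤len = ≤-trans (s≤s⁻¹ (toℕ<n j)) N≤len
      a≤len : a ≤ len W
      a≤len = ≤-trans (<⇒≤ i<j) b≤len

    shorten : ∀ {x y} (W : Walk R x y) → Σ[ W' ∈ Walk R x y ] len W' < N
    shorten W = go W (<-wellFounded (len W))
      where
      go : ∀ {x y} (W : Walk R x y) → Acc _<_ (len W) → Σ[ W' ∈ Walk R x y ] len W' < N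
      go W (acc rs) with len W <? N
      ... | yes short = W , short
      ... | no long   = let W' , shorter = cutLoop W (≮⇒≥ long) in go W' (rs shorter)

  module Unroll {x q q'} (stem : Walk R x q) (r : R q q') (back : Walk R q' q) where

    loop : Walk R q q
    loop = r ◅ back

    unroll : ℕ → S
    unroll j with j <? len stem
    ... | yes _ = at stem j
    ... | no  _ = at loop ((j ∸ len stem) % len loop)

    unroll-stem : ∀ {j} → j < len stem → unroll j ≡ at stem j
    unroll-stem {j} j< with j <? len stem
    ... | yes _ = refl
    ... | no j≮ = ⊥-elim (j≮ j<)

    unroll-loop : ∀ {j} → len stem ≤ j → unroll j ≡ at loop ((j ∸ len stem) % len loop)
    unroll-loop {j} ≤j with j <? len stem
    ... | yes j< = ⊥-elim (<⇒≱ j< ≤j)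
    ... | no _   = refl

    loop-wrap : ∀ {k} → k ≤ len loop → at loop (k % len loop) ≡ at loop k
    loop-wrap k≤ with m≤n⇒m<n∨m≡n k≤
    ... | inj₁ k< = cong (at loop) (m<n⇒m%n≡m k<)
    ... | inj₂ refl = begin
      at loop (len loop % len loop) ≡⟨ cong (at loop) (n%n≡0 (len loop)) ⟩
      at loop 0                     ≡⟨ sym (at-end loop) ⟩
      at loop (len loop)            ∎
      where open ≡-Reasoning

    loop-step : ∀ k → R (at loop (k % len loop)) (at loop (suc k % len loop))
    loop-step k = subst (R (at loop (k % len loop))) (sym around) (steps loop (k % len loop) k%<)
      where
      k%< : k % len loop < len loop
      k%< = m%n<n k (len loop)
      around : at loop (suc k % len loop) ≡ at loop (suc (k % len loop))
      around = trans (cong (at loop) (suc-% k (len loop))) (loop-wrap k%<)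

    unroll-step : ∀ j → R (unroll j) (unroll (suc j))
    unroll-step j with <-≤-connex j (len stem)
    ... | inj₂ stem≤j = subst₂ R (sym (unroll-loop stem≤j)) (sym (unroll-loop (m≤n⇒m≤1+n stem≤j)))
                          (subst (λ k → R (at loop ((j ∸ len stem) % len loop)) (at loop (k % len loop)))
                            (sym (+-∸-assoc 1 stem≤j)) (loop-step (j ∸ len stem)))
    ... | inj₁ j<stem with m≤n⇒m<n∨m≡n j<stem
    ...   | inj₁ 1+j<stem = subst₂ R (sym (unroll-stem j<stem)) (sym (unroll-stem 1+j<stem)) (steps stem j j<stem)
    ...   | inj₂ refl     = subst₂ R (sym (unroll-stem j<stem)) (sym (trans (unroll-loop ≤-refl) entry))
                              (steps stem j j<stem)
      where
      entry : at loop ((suc j ∸ suc j) % len loop) ≡ at stem (suc j)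
      entry = trans (cong (λ k → at loop (k % len loop)) (n∸n≡0 (suc j))) (sym (at-end stem))

    unroll-start : unroll 0 ≡ x
    unroll-start with 0 <? len stem
    ... | yes _ = at-start stem
    ... | no 0≮ with len stem in eq
    ...   | suc _ = ⊥-elim (0≮ (s≤s z≤n))
    ...   | zero  = trans (sym (at-end stem)) (trans (cong (at stem) eq) (at-start stem))

    unroll-period : ∀ i → unroll (len stem + i * len loop) ≡ q
    unroll-period i = begin
      unroll (len stem + i * len loop)
        ≡⟨ unroll-loop (m≤m+n _ _) ⟩
      at loop ((len stem + i * len loop ∸ len stem) % len loop)
        ≡⟨ cong (λ k → at loop (k % len loop)) (m+n∸m≡n (len stem) _) ⟩
      at loop (i * len loop % len loop)
        ≡⟨ cong (at loop) ([m+kn]%n≡m%n 0 i (len loop)) ⟩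
      q ∎
      where open ≡-Reasoning

    unroll-lasso : ∀ {n} (f : S → Fin n) j →
                   lasso {k₀ = len stem} {len back} (tabulate (f ∘ at stem ∘ toℕ)) (tabulate (f ∘ at loop ∘ toℕ)) j
                   ≡ f (unroll j)
    unroll-lasso f j with j <? len stem
    ... | yes j< = trans (lookup∘tabulate (f ∘ at stem ∘ toℕ) (fromℕ< j<))
                         (cong (f ∘ at stem) (toℕ-fromℕ< j<))
    ... | no  _  = trans (lookup∘tabulate (f ∘ at loop ∘ toℕ) ((j ∸ len stem) mod len loop))
                         (cong (f ∘ at loop) (toℕ-fromℕ< (m%n<n (j ∸ len stem) (len loop))))

data Mode (n : ℕ) : Set where
  seeking found : Mode n
  looping       : Fin n → Bool → Mode n

module BlockAutomaton {n : ℕ} (G : CBGraph n) where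
  open CBGraph G

  LabelConstant : (ℕ → Fin n) → ℕ → ℕ → Set
  LabelConstant ρ a b = ∀ i → a ≤ i → i < b → ℓ (ρ i) ≡ ℓ (ρ (suc i))

  PositiveCycle : (ℕ → Fin n) → ℕ → ℕ → Set
  PositiveCycle ρ a b = a < b × ρ a ≡ ρ b × 0 < segCost G ρ a (b ∸ a)

  module _ {ρ : ℕ → Fin n} where

    labelConstant-trivial : ∀ {a b} → b ≤ a → LabelConstant ρ a b
    labelConstant-trivial b≤a i a≤i i<b = ⊥-elim (<⇒≱ i<b (≤-trans b≤a a≤i))

    labelConstant-snoc : ∀ {a b} → LabelConstant ρ a b → ℓ (ρ b) ≡ ℓ (ρ (suc b)) →
                         LabelConstant ρ a (suc b)
    labelConstant-snoc {b = b} constant same i a≤i i<1+b with m≤n⇒m<n∨m≡n (s≤s⁻¹ i<1+b)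
    ... | inj₁ i<b  = constant i a≤i i<b
    ... | inj₂ refl = same

    labelConstant-sub : ∀ {a a' b b'} → a ≤ a' → b' ≤ b → LabelConstant ρ a b → LabelConstant ρ a' b'
    labelConstant-sub a≤a' b'≤b constant i a'≤i i<b' =
      constant i (≤-trans a≤a' a'≤i) (<-≤-trans i<b' b'≤b)

    labelConstant⇒noChangepoint : ∀ {a b} → LabelConstant ρ a b →
                                  ∀ i → a < i → i ≤ b → ¬ Changepoint G ρ i
    labelConstant⇒noChangepoint constant (suc i) a<1+i 1+i≤b differ = differ (constant i (s≤s⁻¹ a<1+i) 1+i≤b)

    noChangepoint⇒labelConstant : ∀ {a b} → (∀ i → a < i → i ≤ b → ¬ Changepoint G ρ i) →
                                  LabelConstant ρ a b
    noChangepoint⇒labelConstant none i a≤i i<b =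
      decidable-stable (ℓ (ρ i) ≟ᵇ ℓ (ρ (suc i))) (none (suc i) (s≤s a≤i) i<b)

    segCost-snoc : ∀ a m → segCost G ρ a (suc m) ≡ segCost G ρ a m + cst (ρ (a + m)) (ρ (suc (a + m)))
    segCost-snoc a zero rewrite +-identityʳ a = +-comm _ 0
    segCost-snoc a (suc m) rewrite segCost-snoc (suc a) m | +-suc a m = sym (+-assoc (cst (ρ a) (ρ (suc a))) _ _)

    segCost-∸-suc : ∀ {a j} → a ≤ j →
                    segCost G ρ a (suc j ∸ a) ≡ segCost G ρ a (j ∸ a) + cst (ρ j) (ρ (suc j))
    segCost-∸-suc {a} {j} a≤j rewrite +-∸-assoc 1 a≤j | segCost-snoc a (j ∸ a) | m+[n∸m]≡n a≤j = refl

    segCost-∸-suc-positive : ∀ {a j} → a ≤ j → 0 < segCost G ρ a (j ∸ a) ⊎ 0 < cst (ρ j) (ρ (suc j)) →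
                             0 < segCost G ρ a (suc j ∸ a)
    segCost-∸-suc-positive a≤j = subst (0 <_) (sym (segCost-∸-suc a≤j)) ∘ +-positive

    segCost-∸-suc-positive⁻ : ∀ {a j} → a ≤ j → 0 < segCost G ρ a (suc j ∸ a) →
                              0 < segCost G ρ a (j ∸ a) ⊎ 0 < cst (ρ j) (ρ (suc j))
    segCost-∸-suc-positive⁻ a≤j = +-positive⁻ _ ∘ subst (0 <_) (segCost-∸-suc a≤j)

    segCost-edge : ∀ j → segCost G ρ j (suc j ∸ j) ≡ cst (ρ j) (ρ (suc j))
    segCost-edge j rewrite m+n∸n≡m 1 j = +-identityʳ _

  data BlockMove (v v' : Fin n) : Mode n → Mode n → Set where
    stay-seeking : BlockMove v v' seeking seeking
    stay-found   : BlockMove v v' found found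
    open-loop    : ∀ {b} → (T b → 0 < cst v v') → BlockMove v v' seeking (looping v b)
    extend-loop  : ∀ {x b b'} → (T b' → T b ⊎ 0 < cst v v') → BlockMove v v' (looping x b) (looping x b')
    self-loop    : 0 < cst v v' → v' ≡ v → BlockMove v v' seeking found
    close-loop   : ∀ {x b} → T b ⊎ 0 < cst v v' → v' ≡ x → BlockMove v v' (looping x b) found

  data Move (v v' : Fin n) : Mode n → Mode n → Set where
    change : ¬ ℓ v ≡ ℓ v' → Move v v' found seeking
    within : ∀ {m m'} → ℓ v ≡ ℓ v' → BlockMove v v' m m' → Move v v' m m'

  found-before-change : ∀ {v v' m m'} → Move v v' m m' → ¬ ℓ v ≡ ℓ v' → m ≡ found
  found-before-change (change _)      _      = refl
  found-before-change (within same _) differ = ⊥-elim (differ same)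

  State : Set
  State = Fin n × Mode n

  Step : State → State → Set
  Step (v , m) (v' , m') = E v v' ≡ true × Move v v' m m'

  module Soundness (τ : ℕ → State) (τ-step : ∀ j → Step (τ j) (τ (suc j)))
                   (τ-start : proj₂ (τ 0) ≡ seeking) where

    σ : ℕ → Fin n
    σ j = proj₁ (τ j)

    Invariant : ℕ → Mode n → Set
    Invariant j seeking       = ⊤
    Invariant j found         = Σ[ a ∈ ℕ ] Σ[ b ∈ ℕ ] PositiveCycle σ a b × b ≤ j × LabelConstant σ a j
    Invariant j (looping x b) =
      Σ[ a ∈ ℕ ] a ≤ j × σ a ≡ x × LabelConstant σ a j × (T b → 0 < segCost G σ a (j ∸ a))

    invariant-blockMove : ∀ {j m m'} → Invariant j m → ℓ (σ j) ≡ ℓ (σ (suc j)) →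
                          BlockMove (σ j) (σ (suc j)) m m' → Invariant (suc j) m'
    invariant-blockMove _ _ stay-seeking = tt
    invariant-blockMove (a , b , cycle , b≤j , constant) same stay-found =
      a , b , cycle , m≤n⇒m≤1+n b≤j , labelConstant-snoc constant same
    invariant-blockMove {j} _ same (open-loop positive) =
      j , n≤1+n j , refl , labelConstant-snoc (labelConstant-trivial ≤-refl) same ,
      λ b → subst (0 <_) (sym (segCost-edge j)) (positive b)
    invariant-blockMove (a , a≤j , σa , constant , positive) same (extend-loop step) =
      a , m≤n⇒m≤1+n a≤j , σa , labelConstant-snoc constant same ,
      λ b' → segCost-∸-suc-positive a≤j (map₁ positive (step b'))
    invariant-blockMove {j} _ same (self-loop positive back) =
      j , suc j , (n<1+n j , sym back , subst (0 <_) (sym (segCost-edge j)) positive) , ≤-refl ,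
      labelConstant-snoc (labelConstant-trivial ≤-refl) same
    invariant-blockMove (a , a≤j , σa , constant , positive) same (close-loop last back) =
      a , _ , (s≤s a≤j , trans σa (sym back) , segCost-∸-suc-positive a≤j (map₁ positive last)) , ≤-refl ,
      labelConstant-snoc constant same

    invariant-move : ∀ {j m m'} → Invariant j m → Move (σ j) (σ (suc j)) m m' → Invariant (suc j) m'
    invariant-move _   (change _)          = tt
    invariant-move inv (within same bmove) = invariant-blockMove inv same bmove

    invariant : ∀ j → Invariant j (proj₂ (τ j))
    invariant zero    = subst (Invariant 0) (sym τ-start) tt
    invariant (suc j) = invariant-move (invariant j) (proj₂ (τ-step j))

    isPath : IsPath G σ
    isPath j = proj₁ (τ-step j)

    isPumpable : IsPumpable G σ
    isPumpable j k (changepoint-j , j≤k , changepoint-1+k , _)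
      with a , b , (a<b , σa≡σb , positive) , b≤k , constant
             ← subst (Invariant k) (found-before-change (proj₂ (τ-step k)) changepoint-1+k) (invariant k)
      with j ≤? a
    ... | yes j≤a = a , b , j≤a , a<b , b≤k , σa≡σb , positive
    ... | no  j≰a = ⊥-elim (labelConstant⇒noChangepoint constant j (≰⇒> j≰a) j≤k changepoint-j)

  module Lifting (ρ : ℕ → Fin n) (ρ-path : IsPath G ρ) (ρ-pumpable : IsPumpable G ρ) where

    data Run : ℕ → ℕ → Mode n → Mode n → Set where
      []  : ∀ {s m} → Run s s m m
      _∷_ : ∀ {s t m m' m''} → Move (ρ s) (ρ (suc s)) m m' → Run (suc s) t m' m'' → Run s t m m''

    _++_ : ∀ {s t u m m' m''} → Run s t m m' → Run t u m' m'' → Run s u m m''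
    []         ++ R₂ = R₂
    (mv ∷ R₁) ++ R₂ = mv ∷ (R₁ ++ R₂)

    splitRun : ∀ {s t p m m'} → Run s t m m' → s ≤ p → p ≤ t →
               Σ[ m'' ∈ Mode n ] Run s p m m'' × Run p t m'' m'
    splitRun [] s≤p p≤s with refl ← ≤-antisym s≤p p≤s = _ , [] , []
    splitRun {m = m} (mv ∷ R) s≤p p≤t with m≤n⇒m<n∨m≡n s≤p
    ... | inj₂ refl = m , [] , mv ∷ R
    ... | inj₁ s<p  = let m'' , R₁ , R₂ = splitRun R s<p p≤t in m'' , mv ∷ R₁ , R₂

    toWalk : ∀ {s t m m'} → Run s t m m' → Walk Step (ρ s , m) (ρ t , m')
    toWalk []       = nil
    toWalk (mv ∷ R) = (ρ-path _ , mv) ◅ toWalk R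

    runAlong : ∀ (mode : ℕ → Mode n) {s t} →
               (∀ i → s ≤ i → i < t → Move (ρ i) (ρ (suc i)) (mode i) (mode (suc i))) →
               s ≤‴ t → Run s t (mode s) (mode t)
    runAlong mode moves ≤‴-refl       = []
    runAlong mode moves (≤‴-step s<t) =
      moves _ ≤-refl (≤‴⇒≤ s<t) ∷ runAlong mode (λ i s<i → moves i (<⇒≤ s<i)) s<t

    seekingRun : ∀ {s t} → s ≤ t → LabelConstant ρ s t → Run s t seeking seeking
    seekingRun s≤t constant =
      runAlong (λ _ → seeking) (λ i s≤i i<t → within (constant i s≤i i<t) stay-seeking) (≤⇒≤‴ s≤t)

    foundRun : ∀ {s t} → s ≤ t → LabelConstant ρ s t → Run s t found found
    foundRun s≤t constant =
      runAlong (λ _ → found) (λ i s≤i i<t → within (constant i s≤i i<t) stay-found) (≤⇒≤‴ s≤t)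

    loopRun : ∀ {a b} → PositiveCycle ρ a b → LabelConstant ρ a b → Run a b seeking found
    loopRun {a} {suc b} (a<1+b , ρa≡ρ1+b , positive) constant with m≤n⇒m<n∨m≡n (s≤s⁻¹ a<1+b)
    ... | inj₂ refl =
      within (constant a ≤-refl a<1+b) (self-loop (subst (0 <_) (segCost-edge a) positive) (sym ρa≡ρ1+b)) ∷ []
    ... | inj₁ a<b  = within (constant a ≤-refl a<1+b) opening
                    ∷ (runAlong (λ i → looping (ρ a) (flag i)) extending (≤⇒≤‴ a<b)
                    ++ (within (constant b (<⇒≤ a<b) ≤-refl) closing ∷ []))
      where
      flag : ℕ → Bool
      flag i = 0 <ᵇ segCost G ρ a (i ∸ a)

      opening : BlockMove (ρ a) (ρ (suc a)) seeking (looping (ρ a) (flag (suc a)))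
      opening = open-loop (λ b → subst (0 <_) (segCost-edge a) (<ᵇ⇒< 0 _ b))

      extending : ∀ i → suc a ≤ i → i < b →
                  Move (ρ i) (ρ (suc i)) (looping (ρ a) (flag i)) (looping (ρ a) (flag (suc i)))
      extending i a<i i<b = within (constant i (<⇒≤ a<i) (m<n⇒m<1+n i<b))
        (extend-loop (map₁ <⇒<ᵇ ∘ segCost-∸-suc-positive⁻ (<⇒≤ a<i) ∘ <ᵇ⇒< 0 _))

      closing : BlockMove (ρ b) (ρ (suc b)) (looping (ρ a) (flag b)) found
      closing = close-loop (map₁ <⇒<ᵇ (segCost-∸-suc-positive⁻ (<⇒≤ a<b) positive)) (sym ρa≡ρ1+b)

    blockRun : ∀ {j k} → Block G ρ j k → Run j (suc k) seeking seeking
    blockRun {j} {k} block@(_ , j≤k , changepoint-1+k , none)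
      with a , b , j≤a , a<b , b≤k , ρa≡ρb , positive ← ρ-pumpable j k block =
      seekingRun j≤a (labelConstant-sub ≤-refl (≤-trans (<⇒≤ a<b) b≤k) constant)
      ++ (loopRun (a<b , ρa≡ρb , positive) (labelConstant-sub j≤a b≤k constant)
      ++ (foundRun b≤k (labelConstant-sub (≤-trans j≤a (<⇒≤ a<b)) ≤-refl constant)
      ++ (change changepoint-1+k ∷ [])))
      where
      constant : LabelConstant ρ j k
      constant = noChangepoint⇒labelConstant none

    lastChangepoint : ∀ {s} → Changepoint G ρ s → ∀ t → s ≤ t →
                      Σ[ j ∈ ℕ ] Changepoint G ρ j × j ≤ t × LabelConstant ρ j t × Run s j seeking seeking
    lastChangepoint {s} changepoint-s t s≤t with m≤n⇒m<n∨m≡n s≤t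
    ... | inj₂ refl = s , changepoint-s , ≤-refl , labelConstant-trivial ≤-refl , []
    lastChangepoint changepoint-s (suc t) _ | inj₁ (s≤s s≤t)
      with j , changepoint-j , j≤t , constant , R ← lastChangepoint changepoint-s t s≤t
      with ℓ (ρ t) ≟ᵇ ℓ (ρ (suc t))
    ... | yes same   = j , changepoint-j , m≤n⇒m≤1+n j≤t , labelConstant-snoc constant same , R
    ... | no  differ = suc t , differ , ≤-refl , labelConstant-trivial ≤-refl ,
                       R ++ blockRun (changepoint-j , j≤t , differ , labelConstant⇒noChangepoint constant)

    runFrom : ∀ {s t} → Changepoint G ρ s → s ≤ t → Run s t seeking seeking
    runFrom {t = t} changepoint-s s≤t with _ , _ , j≤t , constant , R ← lastChangepoint changepoint-s t s≤t =
      R ++ seekingRun j≤t constant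

  module Search (ρ : ℕ → Fin n) (ρ-path : IsPath G ρ) (ρ-pumpable : IsPumpable G ρ)
                (ρ-fair : IsFair G ρ) where
    open Lifting ρ ρ-path ρ-pumpable

    record AcceptingReturn : Set where
      field
        {u p v}       : ℕ
        {mode mode'}  : Mode n
        returns       : ρ u ≡ ρ v
        accepting     : F (ρ p) ≡ true
        prefix        : Run 0 u seeking seeking
        toAccepting   : Run u p seeking mode
        leave         : Move (ρ p) (ρ (suc p)) mode mode'
        fromAccepting : Run (suc p) v mode' seeking

    returnVia : ∀ {u p v} → Run u v seeking seeking → u ≤ p → p < v → ρ u ≡ ρ v → F (ρ p) ≡ true →
                AcceptingReturn
    returnVia R u≤p p<v returns accepting with splitRun R u≤p (<⇒≤ p<v)
    ... | _ , _ , [] = ⊥-elim (<-irrefl refl p<v)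
    ... | _ , toAccepting , leave ∷ fromAccepting = record
      { returns = returns ; accepting = accepting ; prefix = runFrom tt z≤n
      ; toAccepting = toAccepting ; leave = leave ; fromAccepting = fromAccepting }

    changepointAfter? : ∀ lo hi → (Σ[ c ∈ ℕ ] lo < c × Changepoint G ρ c) ⊎ LabelConstant ρ lo hi
    changepointAfter? lo zero = inj₂ (labelConstant-trivial z≤n)
    changepointAfter? lo (suc h) with changepointAfter? lo h
    ... | inj₁ found-one = inj₁ found-one
    ... | inj₂ constant with lo ≤? h
    ...   | no  lo≰h = inj₂ (labelConstant-trivial (≰⇒> lo≰h))
    ...   | yes lo≤h with ℓ (ρ h) ≟ᵇ ℓ (ρ (suc h))
    ...     | yes same   = inj₂ (labelConstant-snoc constant same)
    ...     | no  differ = inj₁ (suc h , s≤s lo≤h , differ)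

    visit : ℕ → ℕ → ℕ
    visit s zero    = proj₁ (ρ-fair s)
    visit s (suc i) = proj₁ (ρ-fair (suc (visit s i)))

    visit-start : ∀ s → s ≤ visit s 0
    visit-start s = proj₁ (proj₂ (ρ-fair s))

    visit-accepting : ∀ s i → F (ρ (visit s i)) ≡ true
    visit-accepting s zero    = proj₂ (proj₂ (ρ-fair s))
    visit-accepting s (suc i) = proj₂ (proj₂ (ρ-fair (suc (visit s i))))

    visit-increasing : ∀ s i → visit s i < visit s (suc i)
    visit-increasing s i = proj₁ (proj₂ (ρ-fair (suc (visit s i))))

    Link : ℕ → ℕ → Set
    Link x y = Σ[ p ∈ ℕ ] x ≤ p × p < y × F (ρ p) ≡ true

    link-trans : ∀ {x y z} → Link x y → Link y z → Link x z
    link-trans (p , x≤p , p<y , accepting) (_ , y≤p' , p'<z , _) =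
      p , x≤p , <-trans p<y (≤-<-trans y≤p' p'<z) , accepting

    -- Among the visits to F after s, either a changepoint follows the first one, or n + 1 of them
    -- lie in one block or the tail, and two of these carry the same vertex.
    nextChangepoint : ∀ s → AcceptingReturn ⊎ (Σ[ c ∈ ℕ ] Changepoint G ρ c × Link s c)
    nextChangepoint s with changepointAfter? (visit s 0) (visit s n)
    ... | inj₁ (c , v₀<c , changepoint-c) =
      inj₂ (c , changepoint-c , visit s 0 , visit-start s , v₀<c , visit-accepting s 0)
    ... | inj₂ constant with i , j , i<j , same ← pigeonhole (n<1+n n) (λ i → ρ (visit s (toℕ i))) =
      inj₁ (returnVia (seekingRun (<⇒≤ vᵢ<vⱼ) (labelConstant-sub v₀≤vᵢ vⱼ≤vₙ constant))
                      ≤-refl vᵢ<vⱼ same (visit-accepting s (toℕ i)))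
      where
      vᵢ<vⱼ : visit s (toℕ i) < visit s (toℕ j)
      vᵢ<vⱼ = increasing⇒mono-< (visit-increasing s) i<j
      v₀≤vᵢ : visit s 0 ≤ visit s (toℕ i)
      v₀≤vᵢ = increasing⇒mono-≤ (visit-increasing s) {j = toℕ i} z≤n
      vⱼ≤vₙ : visit s (toℕ j) ≤ visit s n
      vⱼ≤vₙ = increasing⇒mono-≤ (visit-increasing s) (s≤s⁻¹ (toℕ<n j))

    data Chain : ℕ → ℕ → Set where
      origin : Chain 0 0
      extend : ∀ {k x y} → Chain k x → Link x y → Changepoint G ρ y → Chain (suc k) y

    point : ∀ {k x} → Chain k x → Fin (suc k) → ℕ
    point {x = x} _              fzero    = x
    point         (extend c _ _) (fsuc i) = point c i

    point-changepoint : ∀ {k x} (c : Chain k x) i → Changepoint G ρ (point c i)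
    point-changepoint origin          fzero    = tt
    point-changepoint (extend _ _ cp) fzero    = cp
    point-changepoint (extend c _ _)  (fsuc i) = point-changepoint c i

    link-to-last : ∀ {k y} (c : Chain k y) (i : Fin k) → Link (point c (fsuc i)) y
    link-to-last (extend c l _) fzero    = l
    link-to-last (extend c l _) (fsuc i) = link-trans (link-to-last c i) l

    point-link : ∀ {k x} (c : Chain k x) {i j} → toℕ i < toℕ j → Link (point c j) (point c i)
    point-link c              {fzero}  {fsuc j} _   = link-to-last c j
    point-link (extend c _ _) {fsuc i} {fsuc j} i<j = point-link c (s<s⁻¹ i<j)

    chain : ∀ k → AcceptingReturn ⊎ Σ[ x ∈ ℕ ] Chain k x
    chain zero = inj₂ (0 , origin)
    chain (suc k) with chain k
    ... | inj₁ found-one = inj₁ found-one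
    ... | inj₂ (x , c) with nextChangepoint x
    ...   | inj₁ found-one                = inj₁ found-one
    ...   | inj₂ (y , changepoint-y , l) = inj₂ (y , extend c l changepoint-y)

    acceptingReturn : AcceptingReturn
    acceptingReturn with chain n
    ... | inj₁ found-one = found-one
    ... | inj₂ (_ , c) with i , j , i<j , same ← pigeonhole (n<1+n n) (ρ ∘ point c)
                       with p , u≤p , p<v , accepting ← point-link c i<j =
      returnVia (runFrom (point-changepoint c j) (≤-trans u≤p (<⇒≤ p<v))) u≤p p<v (sym same) accepting

  bit : Bool → Fin 2
  bit false = fzero
  bit true  = fsuc fzero

  bit-injective : ∀ {b b'} → bit b ≡ bit b' → b ≡ b'
  bit-injective {false} {false} _ = refl
  bit-injective {true}  {true}  _ = refl

  stateCount : ℕ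
  stateCount = n * suc (suc (n * 2))

  encodeMode : Mode n → Fin (suc (suc (n * 2)))
  encodeMode seeking       = fzero
  encodeMode found         = fsuc fzero
  encodeMode (looping x b) = fsuc (fsuc (combine x (bit b)))

  encodeMode-injective : ∀ {m m'} → encodeMode m ≡ encodeMode m' → m ≡ m'
  encodeMode-injective {seeking}     {seeking}       _    = refl
  encodeMode-injective {found}       {found}         _    = refl
  encodeMode-injective {looping x b} {looping x' b'} same
    with refl , same-bit ← combine-injective x (bit b) x' (bit b') (fsuc-injective (fsuc-injective same)) =
    cong (looping x) (bit-injective same-bit)

  encode : State → Fin stateCount
  encode (v , m) = combine v (encodeMode m)

  encode-injective : ∀ {q q'} → encode q ≡ encode q' → q ≡ q'
  encode-injective {v , m} {v' , m'} same
    with refl , same-mode ← combine-injective v (encodeMode m) v' (encodeMode m') same =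
    cong (v ,_) (encodeMode-injective same-mode)

  stateCount-bound : stateCount + stateCount ≤ 8 * (n * n)
  stateCount-bound = begin
    stateCount + stateCount       ≡⟨ expand n ⟩
    4 * n + 4 * (n * n)           ≤⟨ +-monoˡ-≤ (4 * (n * n)) (*-monoʳ-≤ 4 (m≤m*m n)) ⟩
    4 * (n * n) + 4 * (n * n)     ≡⟨ double (n * n) ⟩
    8 * (n * n)                   ∎
    where
    open ≤-Reasoning
    expand : ∀ m → m * suc (suc (m * 2)) + m * suc (suc (m * 2)) ≡ 4 * m + 4 * (m * m)
    expand = solve-∀
    double : ∀ m → 4 * m + 4 * m ≡ 8 * m
    double = solve-∀
    m≤m*m : ∀ m → m ≤ m * m
    m≤m*m zero    = z≤n
    m≤m*m (suc m) = m≤m*n (suc m) (suc m)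

  vertices : ∀ {q q'} (W : Walk Step q q') → Vec (Fin n) (len W)
  vertices W = tabulate (proj₁ ∘ at W ∘ toℕ)

  lasso-sound : ∀ {q q'} (stem : Walk Step (vI , seeking) q) (r : Step q q') (back : Walk Step q' q) →
                F (proj₁ q) ≡ true → IsInitialPumpableFairPath G (lasso (vertices stem) (vertices (r ◅ back)))
  lasso-sound stem r back accepting = isPath , initial , isPumpable , fair
    where
    open Unroll stem r back

    σ : ℕ → Fin n
    σ = lasso (vertices stem) (vertices loop)

    σ≡ : ∀ j → σ j ≡ proj₁ (unroll j)
    σ≡ = unroll-lasso proj₁

    -- Pairing the lasso's own vertices with the unrolled modes lets Soundness speak about σ itself.
    τ : ℕ → State
    τ j = σ j , proj₂ (unroll j)

    τ-step : ∀ j → Step (τ j) (τ (suc j))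
    τ-step j = subst₂ Step (unroll≡τ j) (unroll≡τ (suc j)) (unroll-step j)
      where
      unroll≡τ : ∀ j → unroll j ≡ τ j
      unroll≡τ j = cong (_, proj₂ (unroll j)) (sym (σ≡ j))

    open Soundness τ τ-step (cong proj₂ unroll-start) using (isPath; isPumpable)

    initial : IsInitial G σ
    initial = trans (σ≡ 0) (cong proj₁ unroll-start)

    fair : IsFair G σ
    fair i = len stem + i * len loop ,
             ≤-trans (m≤m*n i (len loop)) (m≤n+m _ (len stem)) ,
             trans (cong F (trans (σ≡ _) (cong proj₁ (unroll-period i)))) accepting

  module FromFairPath (ρ : ℕ → Fin n) (ρ-path : IsPath G ρ) (ρ-initial : IsInitial G ρ)
                      (ρ-pumpable : IsPumpable G ρ) (ρ-fair : IsFair G ρ) where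
    open Lifting ρ ρ-path ρ-pumpable
    open Search ρ ρ-path ρ-pumpable ρ-fair
    open AcceptingReturn acceptingReturn

    leaveStep : Step (ρ p , mode) (ρ (suc p) , mode')
    leaveStep = ρ-path p , leave

    stem : Σ[ W ∈ Walk Step (vI , seeking) (ρ p , mode) ] len W < stateCount
    stem = shorten encode encode-injective
             (cast (cong (_, seeking) ρ-initial) refl (toWalk prefix ◅◅ toWalk toAccepting))

    back : Σ[ W ∈ Walk Step (ρ (suc p) , mode') (ρ p , mode) ] len W < stateCount
    back = shorten encode encode-injective
             (toWalk fromAccepting ◅◅ cast (cong (_, seeking) returns) refl (toWalk toAccepting))

    shortLasso : Σ[ k₀ ∈ ℕ ] Σ[ k₁ ∈ ℕ ] Σ[ π₀ ∈ Vec (Fin n) k₀ ] Σ[ π₁ ∈ Vec (Fin n) (suc k₁) ]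
                 IsInitialPumpableFairPath G (lasso π₀ π₁) × k₀ < stateCount × k₁ < stateCount
    shortLasso =
      len (proj₁ stem) , len (proj₁ back) , vertices (proj₁ stem) , vertices (leaveStep ◅ proj₁ back) ,
      lasso-sound (proj₁ stem) leaveStep (proj₁ back) accepting , proj₂ stem , proj₂ back

lemma4 : Σ ℕ λ c →
           (n : ℕ) (G : CBGraph n) →
           Σ (ℕ → Fin n) (λ ρ → IsInitialPumpableFairPath G ρ) →
           Σ ℕ λ k₀ → Σ ℕ λ k₁ →
             Σ (Vec (Fin n) k₀) λ π₀ → Σ (Vec (Fin n) (suc k₁)) λ π₁ →
               IsInitialPumpableFairPath G (lasso π₀ π₁) ×
               k₀ + suc k₁ ≤ c * (n * n)
lemma4 = 8 , λ n G (ρ , path , initial , pumpable , fair) →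
  let open BlockAutomaton G
      k₀ , k₁ , π₀ , π₁ , lasso-ok , k₀< , k₁< = FromFairPath.shortLasso ρ path initial pumpable fair
  in k₀ , k₁ , π₀ , π₁ , lasso-ok , (begin
       k₀ + suc k₁             ≡⟨ +-suc k₀ k₁ ⟩
       suc k₀ + k₁             ≤⟨ +-mono-≤ k₀< (<⇒≤ k₁<) ⟩
       stateCount + stateCount ≤⟨ stateCount-bound ⟩
       8 * (n * n)             ∎)
  where open ≤-Reasoning
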